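{- Let $\pi$ be a uniformly random permutation of $[n]$, let $1\le k\le n$, and fix a pattern $\mu$ (a permutation of $[k]$). For $1\le \ell\le n-k+1$ let $I_\ell$ be the indicator that $(\pi(\ell),\pi(\ell+1),\ldots,\pi(\ell+k-1))$ is in the same relative order as $(\mu(1),\ldots,\mu(k))$. Let $i,j\in\{1,\ldots,n-k+1\}$ be such that the windows $\{j,j+1,\ldots,j+k-1\}$ and $\{i,i+1,\ldots,i+k-1\}$ intersect in exactly $r$ positions. Then \[\mathbb P(I_jI_i=1)\le \frac{2^{2k-2r}}{(2k-r)!}.\] -}

module Defs where

open import Data.Nat using (ℕ; zero; suc; _+_; _≤_; _<_)
open import Data.Nat.Properties using (+-monoʳ-<; <-≤-trans)
open import Data.Fin using (Fin; toℕ; fromℕ<) renaming (_<_ to _<ᶠ_; _<?_ to _<ᶠ?_; _≟_ to _≟ᶠ_)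
open import Data.Fin.Properties using (toℕ<n; all?)
open import Data.Fin.Permutation using (Permutation′; _⟨$⟩ʳ_)
open import Data.Vec using (Vec; []; _∷_; lookup)
open import Data.List using (List; []; _∷_; [_]; map; concatMap; filter; length; upTo; allFin)
open import Data.Product using (_×_)
open import Relation.Binary.PropositionalEquality using (_≡_)
open import Relation.Nullary using (Dec)
open import Relation.Nullary.Decidable using (_×-dec_; _→-dec_)
open import Data.Nat using (_≤?_; _<?_)

allVecs : (n m : ℕ) → List (Vec (Fin n) m)
allVecs n zero    = [ [] ]
allVecs n (suc m) = concatMap (λ x → map (x ∷_) (allVecs n m)) (allFin n)

-- A vector v : Vec (Fin n) n encodes the map π(p) = lookup v p; it is a
-- permutation of [n] iff it is injective.
IsPerm : {n : ℕ} → Vec (Fin n) n → Set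
IsPerm v = ∀ a b → lookup v a ≡ lookup v b → a ≡ b

isPerm? : {n : ℕ} (v : Vec (Fin n) n) → Dec (IsPerm v)
isPerm? v = all? λ a → all? λ b → (lookup v a ≟ᶠ lookup v b) →-dec (a ≟ᶠ b)

-- The sample space: all permutations of [n] (each listed exactly once).
Perms : (n : ℕ) → List (Vec (Fin n) n)
Perms n = filter isPerm? (allVecs n n)

-- Position ℓ + a (0-based) of the window starting at ℓ, for a : Fin k.
winPos : {n k : ℕ} (ℓ : ℕ) → ℓ + k ≤ n → Fin k → Fin n
winPos ℓ hℓ a = fromℕ< (<-≤-trans (+-monoʳ-< ℓ (toℕ<n a)) hℓ)

Occ : {n k : ℕ} → Vec (Fin n) n → Permutation′ k → (ℓ : ℕ) → ℓ + k ≤ n → Set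
Occ {n} {k} v μ ℓ hℓ = ∀ a b →
  ((μ ⟨$⟩ʳ a) <ᶠ (μ ⟨$⟩ʳ b) → lookup v (winPos ℓ hℓ a) <ᶠ lookup v (winPos ℓ hℓ b)) ×
  (lookup v (winPos ℓ hℓ a) <ᶠ lookup v (winPos ℓ hℓ b) → (μ ⟨$⟩ʳ a) <ᶠ (μ ⟨$⟩ʳ b))

occ? : {n k : ℕ} (v : Vec (Fin n) n) (μ : Permutation′ k) (ℓ : ℕ) (hℓ : ℓ + k ≤ n) → Dec (Occ v μ ℓ hℓ)
occ? v μ ℓ hℓ = all? λ a → all? λ b →
  ((μ ⟨$⟩ʳ a <ᶠ? μ ⟨$⟩ʳ b) →-dec (lookup v (winPos ℓ hℓ a) <ᶠ? lookup v (winPos ℓ hℓ b))) ×-dec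
  ((lookup v (winPos ℓ hℓ a) <ᶠ? lookup v (winPos ℓ hℓ b)) →-dec (μ ⟨$⟩ʳ a <ᶠ? μ ⟨$⟩ʳ b))

countBoth : (n k : ℕ) (μ : Permutation′ k) (i j : ℕ) → i + k ≤ n → j + k ≤ n → ℕ
countBoth n k μ i j hi hj = length (filter (λ v → occ? v μ i hi ×-dec occ? v μ j hj) (Perms n))

InWin : (k ℓ p : ℕ) → Set
InWin k ℓ p = (ℓ ≤ p) × (p < ℓ + k)

inWin? : (k ℓ p : ℕ) → Dec (InWin k ℓ p)
inWin? k ℓ p = (ℓ ≤? p) ×-dec (p <? ℓ + k)

overlapSize : (n k i j : ℕ) → ℕ
overlapSize n k i j = length (filter (λ p → inWin? k i p ×-dec inWin? k j p) (upTo n))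

{-# OPTIONS --safe #-}
-- Let the windows start at i ≤ j and put s = min (j − i, k). Their union U has k + s = 2k − r
-- positions: s positions A seen only by the first window, the r shared ones, and s positions B
-- seen only by the second. On a double occurrence π the relative order of π on U is forced by μ
-- except for the interleaving of the values on A with those on B, which is a 0/1 word of length
-- 2s. Hence (π, σ) ↦ (π with its values on U rearranged by σ ∈ S_{k+s}, word) is injective,
-- so countBoth · (k + s)! ≤ n! · 2^(2s).
module Submission where

open import Data.Fin using (Fin; zero; suc; toℕ; fromℕ<; punchIn; punchOut)
  renaming (_<_ to _<ᶠ_; _≤_ to _≤ᶠ_; _<?_ to _<ᶠ?_; _≟_ to _≟ᶠ_)
open import Data.Fin.Permutation using (Permutation′)
open import Data.Fin.Properties
  using (any?; injective⇒≤; toℕ<n; toℕ-fromℕ<; toℕ-injective; punchIn-injective; punchInᵢ≢i; punchOut-injective)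
  renaming (<-cmp to <ᶠ-cmp)
open import Data.List as List
  using (List; []; _∷_; _++_; filter; length; allFin; upTo; cartesianProduct; cartesianProductWith)
open import Data.List.Membership.Propositional using (_∈_)
open import Data.List.Membership.Propositional.Properties
  using ( ∈-lookup; ∈-filter⁺; ∈-filter⁻; ∈-allFin
        ; ∈-cartesianProductWith⁺; ∈-cartesianProductWith⁻; ∈-cartesianProduct⁺; ∈-cartesianProduct⁻)
open import Data.List.Membership.Setoid.Properties using (index-injective)
open import Data.List.Properties
  using ( length-tabulate; length-filter; length-++; length-map
        ; filter-notAll; filter-≐; filter-++; filter-accept; filter-reject; upTo-∷ʳ)
import Data.List.Relation.Unary.All as All
import Data.List.Relation.Unary.Any as Any
open import Data.List.Relation.Unary.Any using (here; there)
open import Data.List.Relation.Unary.Unique.Propositional using (Unique; []; _∷_)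
open import Data.List.Relation.Unary.Unique.Propositional.Properties using (filter⁺; allFin⁺; cartesianProductWith⁺)
open import Data.Nat using (ℕ; zero; suc; _+_; _*_; _∸_; _^_; _⊓_; _⊔_; _≤_; _<_; z≤n; _!; _<?_; _≤?_; _≟_)
open import Data.Nat.Properties
open import Data.Product using (_×_; _,_; proj₁; proj₂; ∃; swap)
open import Data.Product.Properties using (,-injective)
open import Data.Sum using (inj₁; inj₂)
open import Data.Vec as Vec using (Vec; []; _∷_; lookup; tabulate)
open import Data.Vec.Properties using (lookup∘tabulate; tabulate∘lookup; tabulate-cong; lookup-map; ∷-injective)
open import Function using (_∘_)
open import Function.Definitions using (Injective)
open import Level using (0ℓ)
open import Relation.Binary using (tri<; tri≈; tri>)
open import Relation.Binary.PropositionalEquality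
open import Relation.Nullary using (Dec; yes; no; ¬_; contradiction)
open import Relation.Nullary.Decidable using (_×-dec_)
open import Relation.Unary using (Pred; Decidable)

open import Defs

private variable
  A B : Set
  l m n p q : ℕ

-- Counting by injections

unique⇒lookup-injective : {xs : List A} → Unique xs → Injective _≡_ _≡_ (List.lookup xs)
unique⇒lookup-injective (_ ∷ _)     {zero}  {zero}  _  = refl
unique⇒lookup-injective (x∉xs ∷ _)  {zero}  {suc j} eq = contradiction eq (All.lookup x∉xs (∈-lookup j))
unique⇒lookup-injective (x∉xs ∷ _)  {suc i} {zero}  eq = contradiction (sym eq) (All.lookup x∉xs (∈-lookup i))
unique⇒lookup-injective (_ ∷ uxs)   {suc i} {suc j} eq = cong suc (unique⇒lookup-injective uxs eq)

length-≤-injection : {xs : List A} {ys : List B} → Unique xs →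
  (f : ∀ {x} → x ∈ xs → B) → (∀ {x} (x∈ : x ∈ xs) → f x∈ ∈ ys) →
  (∀ {x y} (x∈ : x ∈ xs) (y∈ : y ∈ xs) → f x∈ ≡ f y∈ → x ≡ y) →
  length xs ≤ length ys
length-≤-injection {B = B} uxs f f∈ f-inj = injective⇒≤ λ eq →
  unique⇒lookup-injective uxs (f-inj _ _ (index-injective (setoid B) (f∈ (∈-lookup _)) (f∈ (∈-lookup _)) eq))

length-cartesianProductWith : {C : Set} (f : A → B → C) (xs : List A) (ys : List B) →
  length (cartesianProductWith f xs ys) ≡ length xs * length ys
length-cartesianProductWith f []       ys = refl
length-cartesianProductWith f (x ∷ xs) ys = begin
  length (List.map (f x) ys ++ cartesianProductWith f xs ys) ≡⟨ length-++ (List.map (f x) ys) ⟩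
  length (List.map (f x) ys) + length (cartesianProductWith f xs ys)
    ≡⟨ cong₂ _+_ (length-map (f x) ys) (length-cartesianProductWith f xs ys) ⟩
  length ys + length xs * length ys ∎
  where open ≡-Reasoning

length-allFin : ∀ n → length (allFin n) ≡ n
length-allFin n = length-tabulate (λ i → i)

count : {P : Pred (Fin p) 0ℓ} → Decidable P → ℕ
count {p} P? = length (filter P? (allFin p))

module _ {P : Pred (Fin p) 0ℓ} (P? : Decidable P) where

  count-≤ : count P? ≤ p
  count-≤ = subst (count P? ≤_) (length-allFin _) (length-filter P? (allFin p))

  count-< : (x : Fin p) → ¬ P x → count P? < p
  count-< x ¬px = subst (count P? <_) (length-allFin _)
    (filter-notAll P? (allFin p) (Any.map (λ { refl → ¬px }) (∈-allFin x)))

  ∈-count⁻ : {x : Fin p} → x ∈ filter P? (allFin p) → P x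
  ∈-count⁻ x∈ = proj₂ (∈-filter⁻ P? {xs = allFin p} x∈)

  module _ {Q : Pred (Fin q) 0ℓ} (Q? : Decidable Q) where

    count-≤-injection : (g : ∀ x → P x → Fin q) → (∀ x px → Q (g x px)) →
      (∀ x y px py → g x px ≡ g y py → x ≡ y) → count P? ≤ count Q?
    count-≤-injection g gQ g-inj = length-≤-injection (filter⁺ P? (allFin⁺ p))
      (λ x∈ → g _ (∈-count⁻ x∈))
      (λ x∈ → ∈-filter⁺ Q? (∈-allFin _) (gQ _ _))
      (λ x∈ y∈ → g-inj _ _ _ _)

module _ {P Q : Pred (Fin p) 0ℓ} (P? : Decidable P) (Q? : Decidable Q) where

  count-mono : (∀ x → P x → Q x) → count P? ≤ count Q?
  count-mono P⊆Q = count-≤-injection P? Q? (λ x _ → x) P⊆Q (λ _ _ _ _ eq → eq)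

  count-strict : (∀ x → P x → Q x) → (x : Fin p) → Q x → ¬ P x → count P? < count Q?
  count-strict P⊆Q x qx ¬px = length-≤-injection {xs = x ∷ filter P? (allFin p)}
    (All.tabulate (λ y∈ x≡y → ¬px (subst P (sym x≡y) (∈-count⁻ P? y∈))) ∷ filter⁺ P? (allFin⁺ p))
    (λ {y} _ → y)
    (λ { (here refl) → ∈-filter⁺ Q? (∈-allFin x) qx
       ; (there y∈) → ∈-filter⁺ Q? (∈-allFin _) (P⊆Q _ (∈-count⁻ P? y∈)) })
    (λ _ _ eq → eq)

  count-cong : (∀ x → P x → Q x) → (∀ x → Q x → P x) → count P? ≡ count Q?
  count-cong P⊆Q Q⊆P = cong length (filter-≐ P? Q? ((λ {x} → P⊆Q x) , (λ {x} → Q⊆P x)) (allFin p))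

injective⇒surjective : {w : Fin m → Fin m} → Injective _≡_ _≡_ w → ∀ y → ∃ λ x → w x ≡ y
injective⇒surjective {suc m} {w} w-inj y with any? (λ x → w x ≟ᶠ y)
... | yes hit = hit
... | no miss = contradiction (injective⇒≤ punchOut∘w-inj) (n≮n m)
  where
  y≢w : ∀ x → y ≢ w x
  y≢w x y≡wx = miss (x , sym y≡wx)
  punchOut∘w-inj : Injective _≡_ _≡_ (λ x → punchOut (y≢w x))
  punchOut∘w-inj {x} {x′} eq = w-inj (punchOut-injective (y≢w x) (y≢w x′) eq)

module _ {w : Fin m → Fin m} (w-inj : Injective _≡_ _≡_ w) {P : Pred (Fin m) 0ℓ} (P? : Decidable P) where

  count-∘-injective : count (λ x → P? (w x)) ≡ count P?
  count-∘-injective = ≤-antisym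
    (count-≤-injection (λ x → P? (w x)) P? (λ x _ → w x) (λ _ px → px) (λ _ _ _ _ → w-inj))
    (count-≤-injection P? (λ x → P? (w x)) (λ y _ → preimage y)
      (λ y py → subst P (sym (w∘preimage y)) py)
      (λ y y′ _ _ eq → trans (sym (w∘preimage y)) (trans (cong w eq) (w∘preimage y′))))
    where
    preimage : Fin m → Fin m
    preimage y = proj₁ (injective⇒surjective w-inj y)
    w∘preimage : ∀ y → w (preimage y) ≡ y
    w∘preimage y = proj₂ (injective⇒surjective w-inj y)

-- Enumerating vectors and permutations

lookup-ext : {xs ys : Vec A l} → (∀ i → lookup xs i ≡ lookup ys i) → xs ≡ ys
lookup-ext {xs = xs} {ys} eq = trans (sym (tabulate∘lookup xs)) (trans (tabulate-cong eq) (tabulate∘lookup ys))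

allVecs-suc : ∀ n m → allVecs n (suc m) ≡ cartesianProductWith _∷_ (allFin n) (allVecs n m)
allVecs-suc n m = go (allFin n)
  where
  go : ∀ xs → List.concatMap (λ x → List.map (x ∷_) (allVecs n m)) xs ≡ cartesianProductWith _∷_ xs (allVecs n m)
  go []       = refl
  go (x ∷ xs) = cong (List.map (x ∷_) (allVecs n m) ++_) (go xs)

∈-allVecs : ∀ n m (v : Vec (Fin n) m) → v ∈ allVecs n m
∈-allVecs n zero    []      = here refl
∈-allVecs n (suc m) (x ∷ v) = subst ((x ∷ v) ∈_) (sym (allVecs-suc n m))
  (∈-cartesianProductWith⁺ _∷_ (∈-allFin x) (∈-allVecs n m v))

allVecs-unique : ∀ n m → Unique (allVecs n m)
allVecs-unique n zero    = All.[] ∷ []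
allVecs-unique n (suc m) = subst Unique (sym (allVecs-suc n m))
  (cartesianProductWith⁺ _∷_ ∷-injective (allFin⁺ n) (allVecs-unique n m))

length-allVecs : ∀ n m → length (allVecs n m) ≡ n ^ m
length-allVecs n zero    = refl
length-allVecs n (suc m) = begin
  length (allVecs n (suc m))                                      ≡⟨ cong length (allVecs-suc n m) ⟩
  length (cartesianProductWith _∷_ (allFin n) (allVecs n m))      ≡⟨ length-cartesianProductWith _∷_ (allFin n) _ ⟩
  length (allFin n) * length (allVecs n m)                        ≡⟨ cong₂ _*_ (length-allFin n) (length-allVecs n m) ⟩
  n * n ^ m                                                       ∎
  where open ≡-Reasoning

∈-Perms⁺ : {v : Vec (Fin n) n} → IsPerm v → v ∈ Perms n
∈-Perms⁺ {v = v} = ∈-filter⁺ isPerm? (∈-allVecs _ _ v)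

∈-Perms⁻ : {v : Vec (Fin n) n} → v ∈ Perms n → IsPerm v
∈-Perms⁻ v∈ = proj₂ (∈-filter⁻ isPerm? {xs = allVecs _ _} v∈)

Perms-unique : ∀ n → Unique (Perms n)
Perms-unique n = filter⁺ isPerm? (allVecs-unique n n)

insert : Fin (suc m) → Vec (Fin m) m → Vec (Fin (suc m)) (suc m)
insert x w = x ∷ Vec.map (punchIn x) w

insert-isPerm : ∀ x (w : Vec (Fin m) m) → IsPerm w → IsPerm (insert x w)
insert-isPerm x w w-perm zero    zero    eq = refl
insert-isPerm x w w-perm zero    (suc b) eq = contradiction (trans (sym (lookup-map b (punchIn x) w)) (sym eq)) (punchInᵢ≢i x _)
insert-isPerm x w w-perm (suc a) zero    eq = contradiction (trans (sym (lookup-map a (punchIn x) w)) eq) (punchInᵢ≢i x _)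
insert-isPerm x w w-perm (suc a) (suc b) eq = cong suc (w-perm a b (punchIn-injective x _ _
  (trans (sym (lookup-map a (punchIn x) w)) (trans eq (lookup-map b (punchIn x) w)))))

insert-injective : ∀ {x x′} {w w′ : Vec (Fin m) m} → insert x w ≡ insert x′ w′ → x ≡ x′ × w ≡ w′
insert-injective {x = x} {w = w} {w′} eq with ∷-injective eq
... | refl , map≡map = refl , lookup-ext λ a → punchIn-injective x _ _
  (trans (sym (lookup-map a (punchIn x) w)) (trans (cong (λ v → lookup v a) map≡map) (lookup-map a (punchIn x) w′)))

factorial-≤-Perms : ∀ m → m ! ≤ length (Perms m)
factorial-≤-Perms zero    = ≤-refl
factorial-≤-Perms (suc m) = begin
  suc m * m !                                              ≤⟨ *-monoʳ-≤ (suc m) (factorial-≤-Perms m) ⟩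
  suc m * length (Perms m)                                 ≡⟨ cong (_* length (Perms m)) (length-allFin (suc m)) ⟨
  length (allFin (suc m)) * length (Perms m)               ≡⟨ length-cartesianProductWith insert (allFin (suc m)) (Perms m) ⟨
  length (cartesianProductWith insert (allFin (suc m)) (Perms m))
    ≤⟨ length-≤-injection (cartesianProductWith⁺ insert insert-injective (allFin⁺ (suc m)) (Perms-unique m))
         (λ {v} _ → v) ∈-Perms-insert (λ _ _ eq → eq) ⟩
  length (Perms (suc m))                                   ∎
  where
  open ≤-Reasoning
  ∈-Perms-insert : ∀ {v} → v ∈ cartesianProductWith insert (allFin (suc m)) (Perms m) → v ∈ Perms (suc m)
  ∈-Perms-insert v∈ with ∈-cartesianProductWith⁻ insert (allFin (suc m)) (Perms m) v∈
  ... | x , w , _ , w∈ , refl = ∈-Perms⁺ (insert-isPerm x w (∈-Perms⁻ w∈))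

-- Ranks

CopiesOrder : (f f′ : Fin m → Fin n) → Set
CopiesOrder f f′ = ∀ x y → f x <ᶠ f y → f′ x <ᶠ f′ y

below : (f : Fin m → Fin n) → Fin n → ℕ
below f t = count (λ x → f x <ᶠ? t)

module _ (f : Fin m → Fin n) where

  below-≤ : ∀ t → below f t ≤ m
  below-≤ t = count-≤ (λ x → f x <ᶠ? t)

  below-< : ∀ x → below f (f x) < m
  below-< x = count-< (λ y → f y <ᶠ? f x) x (n≮n _)

  below-mono : ∀ {t t′} → t ≤ᶠ t′ → below f t ≤ below f t′
  below-mono t≤t′ = count-mono (λ x → f x <ᶠ? _) (λ x → f x <ᶠ? _) (λ _ fx<t → <-≤-trans fx<t t≤t′)

  below-strict : ∀ {x t} → f x <ᶠ t → below f (f x) < below f t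
  below-strict {x} fx<t = count-strict (λ y → f y <ᶠ? f x) (λ y → f y <ᶠ? _)
    (λ _ fy<fx → <-trans fy<fx fx<t) x fx<t (n≮n _)

  below-injective : Injective _≡_ _≡_ f → ∀ {x y} → below f (f x) ≡ below f (f y) → x ≡ y
  below-injective f-inj {x} {y} eq with <ᶠ-cmp (f x) (f y)
  ... | tri< fx<fy _ _ = contradiction eq (<⇒≢ (below-strict fx<fy))
  ... | tri≈ _ fx≡fy _ = f-inj fx≡fy
  ... | tri> _ _ fy<fx = contradiction (sym eq) (<⇒≢ (below-strict fy<fx))

below-copies : {f f′ : Fin m → Fin n} → CopiesOrder f f′ → CopiesOrder f′ f →
  ∀ x → below f (f x) ≡ below f′ (f′ x)
below-copies f⇒f′ f′⇒f x = count-cong (λ y → _ <ᶠ? _) (λ y → _ <ᶠ? _) (λ y → f⇒f′ y x) (λ y → f′⇒f y x)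

pointwise⇒copies : {f f′ : Fin m → Fin n} → (∀ x → f x ≡ f′ x) → CopiesOrder f f′
pointwise⇒copies f≗f′ x y = subst₂ _<ᶠ_ (f≗f′ x) (f≗f′ y)

-- Merging two sequences

indicator : {P : Set} → Dec P → Fin 2
indicator (yes _) = suc zero
indicator (no _)  = zero

indicator⁻ : {P : Set} (P? : Dec P) → indicator P? ≡ suc zero → P
indicator⁻ (yes p) _ = p

indicator⁺ : {P : Set} (P? : Dec P) → P → indicator P? ≡ suc zero
indicator⁺ (yes _)  _ = refl
indicator⁺ (no ¬p)  p = contradiction p ¬p

Marked : Vec (Fin 2) l → Fin l → Set
Marked c t = lookup c t ≡ suc zero

markedBelow? : (c : Vec (Fin 2) l) (x : ℕ) → Decidable (λ t → Marked c t × toℕ t < x)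
markedBelow? c x t = (lookup c t ≟ᶠ suc zero) ×-dec (toℕ t <? x)

marksBelow : Vec (Fin 2) l → ℕ → ℕ
marksBelow c x = count (markedBelow? c x)

marksBelow-strict : (c : Vec (Fin 2) l) {t : Fin l} {x : ℕ} → Marked c t → toℕ t < x →
  marksBelow c (toℕ t) < marksBelow c x
marksBelow-strict c {t} marked t<x = count-strict (markedBelow? c (toℕ t)) (markedBelow? c _)
  (λ _ (marked-s , s<t) → marked-s , <-trans s<t t<x) t (marked , t<x) (λ (_ , t<t) → n≮n _ t<t)

-- position a is the index of g a in the increasing merge of the values of g and h, and
-- code marks the indices taken by g.
module Merge (g : Fin p → Fin n) (h : Fin q → Fin n) where

  position : Fin p → ℕ
  position a = below g (g a) + below h (g a)

  position< : ∀ a → position a < p + q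
  position< a = +-mono-<-≤ (below-< g a) (below-≤ h (g a))

  position-strict : ∀ {a a′} → g a′ <ᶠ g a → position a′ < position a
  position-strict lt = +-mono-<-≤ (below-strict g lt) (below-mono h (<⇒≤ lt))

  position-mono : ∀ {a a′} → g a ≤ᶠ g a′ → position a ≤ position a′
  position-mono le = +-mono-≤ (below-mono g le) (below-mono h le)

  position-injective : Injective _≡_ _≡_ g → Injective _≡_ _≡_ position
  position-injective g-inj {a} {a′} eq with <ᶠ-cmp (g a) (g a′)
  ... | tri< ga<ga′ _ _ = contradiction eq (<⇒≢ (position-strict ga<ga′))
  ... | tri≈ _ ga≡ga′ _ = g-inj ga≡ga′
  ... | tri> _ _ ga′<ga = contradiction (sym eq) (<⇒≢ (position-strict ga′<ga))

  slot : Fin p → Fin (p + q)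
  slot a = fromℕ< (position< a)

  toℕ-slot : ∀ a → toℕ (slot a) ≡ position a
  toℕ-slot a = toℕ-fromℕ< (position< a)

  Taken : Fin (p + q) → Set
  Taken t = ∃ λ a → position a ≡ toℕ t

  taken? : ∀ t → Dec (Taken t)
  taken? t = any? (λ a → position a ≟ toℕ t)

  code : Vec (Fin 2) (p + q)
  code = tabulate (λ t → indicator (taken? t))

  marked⇒taken : ∀ {t} → Marked code t → Taken t
  marked⇒taken {t} marked = indicator⁻ (taken? t) (trans (sym (lookup∘tabulate _ t)) marked)

  slot-marked : ∀ a → Marked code (slot a)
  slot-marked a = trans (lookup∘tabulate _ (slot a)) (indicator⁺ (taken? (slot a)) (a , sym (toℕ-slot a)))

  marksBelow-strict-position : ∀ {a x} → position a < x → marksBelow code (position a) < marksBelow code x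
  marksBelow-strict-position {a} {x} lt = subst (λ y → marksBelow code y < marksBelow code x) (toℕ-slot a)
    (marksBelow-strict code (slot-marked a) (subst (_< x) (sym (toℕ-slot a)) lt))

  position-reflects-< : ∀ {a a′} → position a′ < position a → g a′ <ᶠ g a
  position-reflects-< {a} {a′} lt with g a′ <ᶠ? g a
  ... | yes ga′<ga = ga′<ga
  ... | no ga′≮ga = contradiction lt (≤⇒≯ (position-mono (≮⇒≥ ga′≮ga)))

  taken-injective : ∀ {t t′} (x : Taken t) (y : Taken t′) → proj₁ x ≡ proj₁ y → t ≡ t′
  taken-injective (a , e) (.a , e′) refl = toℕ-injective (trans (sym e) e′)

  marksBelow-position : Injective _≡_ _≡_ g → ∀ a → marksBelow code (position a) ≡ below g (g a)
  marksBelow-position g-inj a = ≤-antisym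
    (count-≤-injection (markedBelow? code (position a)) (λ a′ → g a′ <ᶠ? g a)
      (λ t (marked , _) → proj₁ (marked⇒taken marked))
      (λ t (marked , t<pos) → position-reflects-< (subst (_< position a) (sym (proj₂ (marked⇒taken marked))) t<pos))
      (λ t t′ (marked , _) (marked′ , _) → taken-injective (marked⇒taken marked) (marked⇒taken marked′)))
    (count-≤-injection (λ a′ → g a′ <ᶠ? g a) (markedBelow? code (position a))
      (λ a′ _ → slot a′)
      (λ a′ ga′<ga → slot-marked a′ , subst (_< position a) (sym (toℕ-slot a′)) (position-strict ga′<ga))
      (λ a′ a″ _ _ eq → position-injective g-inj (trans (sym (toℕ-slot a′)) (trans (cong toℕ eq) (toℕ-slot a″)))))

module _ {g g′ : Fin p → Fin n} {h h′ : Fin q → Fin n}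
  (g-inj : Injective _≡_ _≡_ g) (g′-inj : Injective _≡_ _≡_ g′)
  (g⇒g′ : CopiesOrder g g′) (g′⇒g : CopiesOrder g′ g)
  (h⇒h′ : CopiesOrder h h′) (h′⇒h : CopiesOrder h′ h)
  (same-code : Merge.code g h ≡ Merge.code g′ h′) where

  private
    module M = Merge g h
    module M′ = Merge g′ h′

  same-marksBelow : ∀ a → marksBelow M.code (M.position a) ≡ marksBelow M.code (M′.position a)
  same-marksBelow a = begin
    marksBelow M.code (M.position a)    ≡⟨ M.marksBelow-position g-inj a ⟩
    below g (g a)                        ≡⟨ below-copies g⇒g′ g′⇒g a ⟩
    below g′ (g′ a)                      ≡⟨ M′.marksBelow-position g′-inj a ⟨
    marksBelow M′.code (M′.position a)   ≡⟨ cong (λ c → marksBelow c (M′.position a)) same-code ⟨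
    marksBelow M.code (M′.position a)    ∎
    where open ≡-Reasoning

  -- Both positions are marked and are preceded by equally many marked indices.
  merge-position-≡ : ∀ a → M.position a ≡ M′.position a
  merge-position-≡ a with <-cmp (M.position a) (M′.position a)
  ... | tri< lt _ _ = contradiction (same-marksBelow a) (<⇒≢ (M.marksBelow-strict-position lt))
  ... | tri≈ _ eq _ = eq
  ... | tri> _ _ gt = contradiction (sym (same-marksBelow a))
    (<⇒≢ (subst (λ c → marksBelow c (M′.position a) < marksBelow c (M.position a)) (sym same-code)
      (M′.marksBelow-strict-position gt)))

  merge-copies-cross : ∀ a b → h b <ᶠ g a → h′ b <ᶠ g′ a
  merge-copies-cross a b hb<ga with h′ b <ᶠ? g′ a
  ... | yes h′b<g′a = h′b<g′a
  ... | no h′b≮g′a = contradiction (begin-strict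
      below h (h b)     <⟨ below-strict h hb<ga ⟩
      below h (g a)     ≡⟨ same-below-h ⟩
      below h′ (g′ a)   ≤⟨ below-mono h′ (≮⇒≥ h′b≮g′a) ⟩
      below h′ (h′ b)   ≡⟨ below-copies h⇒h′ h′⇒h b ⟨
      below h (h b)     ∎) (n≮n _)
    where
    open ≤-Reasoning
    same-below-h : below h (g a) ≡ below h′ (g′ a)
    same-below-h = +-cancelˡ-≡ (below g (g a)) _ _ (begin-equality
      M.position a                      ≡⟨ merge-position-≡ a ⟩
      M′.position a                     ≡⟨ cong (_+ below h′ (g′ a)) (below-copies g⇒g′ g′⇒g a) ⟨
      below g (g a) + below h′ (g′ a)   ∎)

-- Two overlapping windows

module _ {s : ℕ} {f f′ : Fin m → Fin n} where

  copies-on-image : {e : Fin s → Fin m} → CopiesOrder (f ∘ e) (f′ ∘ e) →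
    ∀ {c d} → (∃ λ a → e a ≡ c) → (∃ λ b → e b ≡ d) → f c <ᶠ f d → f′ c <ᶠ f′ d
  copies-on-image copies (a , refl) (b , refl) = copies a b

  copies-restrict : {s′ : ℕ} {e : Fin s → Fin m} {e′ : Fin s′ → Fin m} → (∀ a → ∃ λ b → e b ≡ e′ a) →
    CopiesOrder (f ∘ e) (f′ ∘ e) → CopiesOrder (f ∘ e′) (f′ ∘ e′)
  copies-restrict e′⊆e copies a a′ = copies-on-image copies (e′⊆e a) (e′⊆e a′)

module _ {s : ℕ} (ℓ : ℕ) (ℓ+s≤m : ℓ + s ≤ m) where

  toℕ-winPos : ∀ a → toℕ (winPos ℓ ℓ+s≤m a) ≡ ℓ + toℕ a
  toℕ-winPos a = toℕ-fromℕ< _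

  winPos-injective : Injective _≡_ _≡_ (winPos ℓ ℓ+s≤m)
  winPos-injective eq = toℕ-injective (+-cancelˡ-≡ ℓ _ _
    (trans (sym (toℕ-winPos _)) (trans (cong toℕ eq) (toℕ-winPos _))))

  winPos-cover : ∀ c → ℓ ≤ toℕ c → toℕ c < ℓ + s → ∃ λ a → winPos ℓ ℓ+s≤m a ≡ c
  winPos-cover c ℓ≤c c<ℓ+s = fromℕ< c∸ℓ<s , toℕ-injective (begin
      toℕ (winPos ℓ ℓ+s≤m (fromℕ< c∸ℓ<s)) ≡⟨ toℕ-winPos _ ⟩
      ℓ + toℕ (fromℕ< c∸ℓ<s)             ≡⟨ cong (ℓ +_) (toℕ-fromℕ< c∸ℓ<s) ⟩
      ℓ + (toℕ c ∸ ℓ)                     ≡⟨ m+[n∸m]≡n ℓ≤c ⟩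
      toℕ c                               ∎)
    where
    open ≡-Reasoning
    c∸ℓ<s : toℕ c ∸ ℓ < s
    c∸ℓ<s = subst (toℕ c ∸ ℓ <_) (m+n∸m≡n ℓ s) (∸-monoˡ-< c<ℓ+s ℓ≤c)

-- Fin (k + q) indexes the union of two windows of length k, the second starting q later;
-- leftPart and rightPart are the indices seen by only one of them.
module Union {k q : ℕ} (q≤k : q ≤ k) where

  private
    k≤k+q : k ≤ k + q
    k≤k+q = m≤m+n k q
    q+k≤k+q : q + k ≤ k + q
    q+k≤k+q = ≤-reflexive (+-comm q k)
    q≤k+q : q ≤ k + q
    q≤k+q = ≤-trans q≤k k≤k+q

  firstWindow secondWindow : Fin k → Fin (k + q)
  firstWindow  = winPos 0 k≤k+q
  secondWindow = winPos q q+k≤k+q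

  leftPart rightPart : Fin q → Fin (k + q)
  leftPart  = winPos 0 q≤k+q
  rightPart = winPos k ≤-refl

  toℕ-firstWindow : ∀ a → toℕ (firstWindow a) ≡ toℕ a
  toℕ-firstWindow = toℕ-winPos 0 k≤k+q

  toℕ-secondWindow : ∀ a → toℕ (secondWindow a) ≡ q + toℕ a
  toℕ-secondWindow = toℕ-winPos q q+k≤k+q

  code : (Fin (k + q) → Fin n) → Vec (Fin 2) (q + q)
  code f = Merge.code (f ∘ leftPart) (f ∘ rightPart)

  firstWindow-cover : ∀ c → toℕ c < k → ∃ λ a → firstWindow a ≡ c
  firstWindow-cover c c<k = winPos-cover 0 k≤k+q c z≤n c<k

  secondWindow-cover : ∀ c → q ≤ toℕ c → ∃ λ a → secondWindow a ≡ c
  secondWindow-cover c q≤c = winPos-cover q q+k≤k+q c q≤c (subst (toℕ c <_) (+-comm k q) (toℕ<n c))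

  leftPart-cover : ∀ c → toℕ c < q → ∃ λ a → leftPart a ≡ c
  leftPart-cover c c<q = winPos-cover 0 q≤k+q c z≤n c<q

  rightPart-cover : ∀ c → k ≤ toℕ c → ∃ λ b → rightPart b ≡ c
  rightPart-cover c k≤c = winPos-cover k ≤-refl c k≤c (toℕ<n c)

  leftPart≢rightPart : ∀ a b → leftPart a ≢ rightPart b
  leftPart≢rightPart a b eq = <⇒≱ (<-≤-trans (toℕ<n a) q≤k) (begin
      k                       ≤⟨ m≤m+n k (toℕ b) ⟩
      k + toℕ b               ≡⟨ toℕ-winPos k ≤-refl b ⟨
      toℕ (rightPart b)       ≡⟨ cong toℕ eq ⟨
      toℕ (leftPart a)        ≡⟨ toℕ-winPos 0 q≤k+q a ⟩
      toℕ a                   ∎)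
    where open ≤-Reasoning

  data Placement (c d : Fin (k + q)) : Set where
    both-first  : toℕ c < k → toℕ d < k → Placement c d
    both-second : q ≤ toℕ c → q ≤ toℕ d → Placement c d
    left-right  : toℕ c < q → k ≤ toℕ d → Placement c d
    right-left  : k ≤ toℕ c → toℕ d < q → Placement c d

  placement : ∀ c d → Placement c d
  placement c d with toℕ c <? q | toℕ d <? k | toℕ d <? q | toℕ c <? k
  ... | yes c<q | yes d<k | _       | _       = both-first (<-≤-trans c<q q≤k) d<k
  ... | yes c<q | no d≮k  | _       | _       = left-right c<q (≮⇒≥ d≮k)
  ... | no c≮q  | _       | no d≮q  | _       = both-second (≮⇒≥ c≮q) (≮⇒≥ d≮q)
  ... | no c≮q  | _       | yes d<q | yes c<k = both-first c<k (<-≤-trans d<q q≤k)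
  ... | no c≮q  | _       | yes d<q | no c≮k  = right-left (≮⇒≥ c≮k) d<q

  leftPart⊆firstWindow : ∀ a → ∃ λ a′ → firstWindow a′ ≡ leftPart a
  leftPart⊆firstWindow a = firstWindow-cover (leftPart a)
    (subst (_< k) (sym (toℕ-winPos 0 q≤k+q a)) (<-≤-trans (toℕ<n a) q≤k))

  rightPart⊆secondWindow : ∀ b → ∃ λ b′ → secondWindow b′ ≡ rightPart b
  rightPart⊆secondWindow b = secondWindow-cover (rightPart b)
    (subst (q ≤_) (sym (toℕ-winPos k ≤-refl b)) (≤-trans q≤k (m≤m+n k (toℕ b))))

  leftPart-copies : (f f′ : Fin (k + q) → Fin n) →
    CopiesOrder (f ∘ firstWindow) (f′ ∘ firstWindow) → CopiesOrder (f ∘ leftPart) (f′ ∘ leftPart)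
  leftPart-copies f f′ = copies-restrict {f = f} {f′} leftPart⊆firstWindow

  rightPart-copies : (f f′ : Fin (k + q) → Fin n) →
    CopiesOrder (f ∘ secondWindow) (f′ ∘ secondWindow) → CopiesOrder (f ∘ rightPart) (f′ ∘ rightPart)
  rightPart-copies f f′ = copies-restrict {f = f} {f′} rightPart⊆secondWindow

  module _ {f f′ : Fin (k + q) → Fin n} (f-inj : Injective _≡_ _≡_ f) (f′-inj : Injective _≡_ _≡_ f′)
    (first⇒ : CopiesOrder (f ∘ firstWindow) (f′ ∘ firstWindow))
    (first⇐ : CopiesOrder (f′ ∘ firstWindow) (f ∘ firstWindow))
    (second⇒ : CopiesOrder (f ∘ secondWindow) (f′ ∘ secondWindow))
    (second⇐ : CopiesOrder (f′ ∘ secondWindow) (f ∘ secondWindow))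
    (same-code : code f ≡ code f′) where

    private
      leftPart-injective : ∀ {g : Fin (k + q) → Fin n} → Injective _≡_ _≡_ g → Injective _≡_ _≡_ (g ∘ leftPart)
      leftPart-injective g-inj eq = winPos-injective 0 q≤k+q (g-inj eq)

      copies-right<left : ∀ a b → f (rightPart b) <ᶠ f (leftPart a) → f′ (rightPart b) <ᶠ f′ (leftPart a)
      copies-right<left = merge-copies-cross (leftPart-injective f-inj) (leftPart-injective f′-inj)
        (leftPart-copies f f′ first⇒) (leftPart-copies f′ f first⇐)
        (rightPart-copies f f′ second⇒) (rightPart-copies f′ f second⇐)
        same-code

      reflects-right<left : ∀ a b → f′ (rightPart b) <ᶠ f′ (leftPart a) → f (rightPart b) <ᶠ f (leftPart a)
      reflects-right<left = merge-copies-cross (leftPart-injective f′-inj) (leftPart-injective f-inj)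
        (leftPart-copies f′ f first⇐) (leftPart-copies f f′ first⇒)
        (rightPart-copies f′ f second⇐) (rightPart-copies f f′ second⇒)
        (sym same-code)

      copies-left<right : ∀ a b → f (leftPart a) <ᶠ f (rightPart b) → f′ (leftPart a) <ᶠ f′ (rightPart b)
      copies-left<right a b lt with <ᶠ-cmp (f′ (leftPart a)) (f′ (rightPart b))
      ... | tri< lt′ _ _ = lt′
      ... | tri≈ _ eq _ = contradiction (f′-inj eq) (leftPart≢rightPart a b)
      ... | tri> _ _ gt = contradiction (reflects-right<left a b gt) (<-asym lt)

    copiesOrder-from-windows : CopiesOrder f f′
    copiesOrder-from-windows c d with placement c d
    ... | both-first c<k d<k = copies-on-image first⇒ (firstWindow-cover c c<k) (firstWindow-cover d d<k)
    ... | both-second q≤c q≤d = copies-on-image second⇒ (secondWindow-cover c q≤c) (secondWindow-cover d q≤d)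
    ... | left-right c<q k≤d with leftPart-cover c c<q | rightPart-cover d k≤d
    ...   | a , refl | b , refl = copies-left<right a b
    copiesOrder-from-windows c d | right-left k≤c d<q with rightPart-cover c k≤c | leftPart-cover d d<q
    ...   | b , refl | a , refl = copies-right<left a b

-- Relabelling a permutation on the image of an injection

module Relabel {u : Fin m → Fin n} (u-inj : Injective _≡_ _≡_ u) where

  data Location (p : Fin n) : Set where
    inside  : ∀ c → u c ≡ p → Location p
    outside : (∀ c → u c ≢ p) → Location p

  locate : ∀ p → Location p
  locate p with any? (λ c → u c ≟ᶠ p)
  ... | yes (c , eq) = inside c eq
  ... | no miss      = outside (λ c eq → miss (c , eq))

  private
    relabelAt : Vec (Fin n) n → Vec (Fin m) m → ∀ {p} → Location p → Fin n
    relabelAt v w     (inside c _) = lookup v (u (lookup w c))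
    relabelAt v w {p} (outside _)  = lookup v p

  relabel : Vec (Fin n) n → Vec (Fin m) m → Vec (Fin n) n
  relabel v w = tabulate (λ p → relabelAt v w (locate p))

  relabel-image : ∀ v w c → lookup (relabel v w) (u c) ≡ lookup v (u (lookup w c))
  relabel-image v w c = trans (lookup∘tabulate _ (u c)) (go (locate (u c)))
    where
    go : (loc : Location (u c)) → relabelAt v w loc ≡ lookup v (u (lookup w c))
    go (inside c′ eq) = cong (λ c″ → lookup v (u (lookup w c″))) (u-inj eq)
    go (outside out)  = contradiction refl (out c)

  relabel-outside : ∀ v w {p} → (∀ c → u c ≢ p) → lookup (relabel v w) p ≡ lookup v p
  relabel-outside v w {p} out = trans (lookup∘tabulate _ p) (go (locate p))
    where
    go : (loc : Location p) → relabelAt v w loc ≡ lookup v p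
    go (inside c eq) = contradiction eq (out c)
    go (outside _)   = refl

  relabel-isPerm : ∀ {v w} → IsPerm v → IsPerm w → IsPerm (relabel v w)
  relabel-isPerm {v} {w} v-perm w-perm p p′ eq with locate p | locate p′
  ... | inside c refl | inside c′ refl = cong u (w-perm c c′ (u-inj (v-perm _ _
          (trans (sym (relabel-image v w c)) (trans eq (relabel-image v w c′))))))
  ... | inside c refl | outside out′ = contradiction (v-perm _ _
          (trans (sym (relabel-image v w c)) (trans eq (relabel-outside v w out′)))) (out′ (lookup w c))
  ... | outside out | inside c′ refl = contradiction (v-perm _ _
          (trans (sym (relabel-image v w c′)) (trans (sym eq) (relabel-outside v w out)))) (out (lookup w c′))
  ... | outside out | outside out′ = v-perm p p′
          (trans (sym (relabel-outside v w out)) (trans eq (relabel-outside v w out′)))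

  module _ {v v′ : Vec (Fin n) n} {w w′ : Vec (Fin m) m}
    (v-perm : IsPerm v) (w-perm : IsPerm w) (w′-perm : IsPerm w′)
    (v⇒v′ : CopiesOrder (lookup v ∘ u) (lookup v′ ∘ u)) (v′⇒v : CopiesOrder (lookup v′ ∘ u) (lookup v ∘ u))
    (same-relabel : relabel v w ≡ relabel v′ w′) where

    private
      f f′ : Fin m → Fin n
      f  = lookup v ∘ u
      f′ = lookup v′ ∘ u

      f-inj : Injective _≡_ _≡_ f
      f-inj eq = u-inj (v-perm _ _ eq)

      f∘w≗f′∘w′ : ∀ c → f (lookup w c) ≡ f′ (lookup w′ c)
      f∘w≗f′∘w′ c = begin
        f (lookup w c)                      ≡⟨ relabel-image v w c ⟨
        lookup (relabel v w) (u c)          ≡⟨ cong (λ x → lookup x (u c)) same-relabel ⟩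
        lookup (relabel v′ w′) (u c)        ≡⟨ relabel-image v′ w′ c ⟩
        f′ (lookup w′ c)                    ∎
        where open ≡-Reasoning

    -- w c is the rank of the value at u c in the order that v and v′ induce on the image of u.
    relabel-injectiveʳ : w ≡ w′
    relabel-injectiveʳ = lookup-ext λ c → below-injective f f-inj (begin
      below f (f (W c))                   ≡⟨ count-∘-injective (λ {x} {y} → w-perm x y) (λ d → f d <ᶠ? f (W c)) ⟨
      below (f ∘ W) (f (W c))
        ≡⟨ below-copies (pointwise⇒copies f∘w≗f′∘w′) (pointwise⇒copies (sym ∘ f∘w≗f′∘w′)) c ⟩
      below (f′ ∘ W′) (f′ (W′ c))
        ≡⟨ count-∘-injective (λ {x} {y} → w′-perm x y) (λ d → f′ d <ᶠ? f′ (W′ c)) ⟩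
      below f′ (f′ (W′ c))                ≡⟨ below-copies v′⇒v v⇒v′ (W′ c) ⟩
      below f (f (W′ c))                  ∎)
      where
      open ≡-Reasoning
      W W′ : Fin m → Fin m
      W  = lookup w
      W′ = lookup w′

    relabel-injectiveˡ : v ≡ v′
    relabel-injectiveˡ = lookup-ext λ p → go p (locate p)
      where
      go : ∀ p → Location p → lookup v p ≡ lookup v′ p
      go p (inside c refl) with injective⇒surjective (λ {x} {y} → w-perm x y) c
      ... | c′ , refl = trans (f∘w≗f′∘w′ c′) (cong f′ (cong (λ x → lookup x c′) (sym relabel-injectiveʳ)))
      go p (outside out) = trans (sym (relabel-outside v w out))
        (trans (cong (λ x → lookup x p) same-relabel) (relabel-outside v′ w′ out))

module _ (u : Fin m → Fin n) (u-inj : Injective _≡_ _≡_ u)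
  {Good : Pred (Vec (Fin n) n) 0ℓ} (Good? : Decidable Good)
  (signature : Vec (Fin n) n → Vec (Fin 2) l)
  (signature-fixes-order : ∀ {v v′} → IsPerm v → IsPerm v′ → Good v → Good v′ →
     signature v ≡ signature v′ → CopiesOrder (lookup v ∘ u) (lookup v′ ∘ u)) where

  open Relabel u-inj

  filter-Perms-bound : length (filter Good? (Perms n)) * length (Perms m) ≤ length (Perms n) * 2 ^ l
  filter-Perms-bound = begin
    length (filter Good? (Perms n)) * length (Perms m)   ≡⟨ length-cartesianProductWith _,_ (filter Good? (Perms n)) (Perms m) ⟨
    length Domain
      ≤⟨ length-≤-injection Domain-unique (λ {vw} _ → encode vw) encode-∈ encode-injective ⟩
    length Codomain                                      ≡⟨ length-cartesianProductWith _,_ (Perms n) (allVecs 2 l) ⟩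
    length (Perms n) * length (allVecs 2 l)              ≡⟨ cong (length (Perms n) *_) (length-allVecs 2 l) ⟩
    length (Perms n) * 2 ^ l                             ∎
    where
    open ≤-Reasoning

    Domain : List (Vec (Fin n) n × Vec (Fin m) m)
    Domain = cartesianProduct (filter Good? (Perms n)) (Perms m)

    Codomain : List (Vec (Fin n) n × Vec (Fin 2) l)
    Codomain = cartesianProduct (Perms n) (allVecs 2 l)

    encode : Vec (Fin n) n × Vec (Fin m) m → Vec (Fin n) n × Vec (Fin 2) l
    encode (v , w) = relabel v w , signature v

    Domain-unique : Unique Domain
    Domain-unique = cartesianProductWith⁺ _,_ ,-injective (filter⁺ Good? (Perms-unique n)) (Perms-unique m)

    ∈-Domain⁻ : ∀ {v w} → (v , w) ∈ Domain → (IsPerm v × Good v) × IsPerm w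
    ∈-Domain⁻ vw∈ with ∈-cartesianProduct⁻ (filter Good? (Perms n)) (Perms m) vw∈
    ... | v∈ , w∈ with ∈-filter⁻ Good? {xs = Perms n} v∈
    ...   | v∈Perms , good = (∈-Perms⁻ v∈Perms , good) , ∈-Perms⁻ w∈

    encode-∈ : ∀ {vw} → vw ∈ Domain → encode vw ∈ Codomain
    encode-∈ {v , w} vw∈ with ∈-Domain⁻ vw∈
    ... | (v-perm , _) , w-perm = ∈-cartesianProduct⁺ (∈-Perms⁺ (relabel-isPerm v-perm w-perm)) (∈-allVecs 2 l (signature v))

    encode-injective : ∀ {vw vw′} → vw ∈ Domain → vw′ ∈ Domain → encode vw ≡ encode vw′ → vw ≡ vw′
    encode-injective {v , w} {v′ , w′} vw∈ vw′∈ eq with ∈-Domain⁻ vw∈ | ∈-Domain⁻ vw′∈ | ,-injective eq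
    ... | (v-perm , good) , w-perm | (v′-perm , good′) , w′-perm | same-relabel , same-signature =
      cong₂ _,_ (relabel-injectiveˡ v-perm w-perm w′-perm v⇒v′ v′⇒v same-relabel)
                (relabel-injectiveʳ v-perm w-perm w′-perm v⇒v′ v′⇒v same-relabel)
      where
      v⇒v′ : CopiesOrder (lookup v ∘ u) (lookup v′ ∘ u)
      v⇒v′ = signature-fixes-order v-perm v′-perm good good′ same-signature
      v′⇒v : CopiesOrder (lookup v′ ∘ u) (lookup v ∘ u)
      v′⇒v = signature-fixes-order v′-perm v-perm good′ good (sym same-signature)

length-filter-upTo-suc : {P : Pred ℕ 0ℓ} (P? : Decidable P) (n : ℕ) →
  length (filter P? (upTo (suc n))) ≡ length (filter P? (upTo n)) + length (filter P? List.[ n ])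
length-filter-upTo-suc P? n = begin
  length (filter P? (upTo (suc n)))                                ≡⟨ cong (length ∘ filter P?) (upTo-∷ʳ n) ⟨
  length (filter P? (upTo n ++ List.[ n ]))                        ≡⟨ cong length (filter-++ P? (upTo n) _) ⟩
  length (filter P? (upTo n) ++ filter P? List.[ n ])              ≡⟨ length-++ (filter P? (upTo n)) ⟩
  length (filter P? (upTo n)) + length (filter P? List.[ n ])      ∎
  where open ≡-Reasoning

inInterval? : (a b p : ℕ) → Dec (a ≤ p × p < b)
inInterval? a b p = (a ≤? p) ×-dec (p <? b)

count-interval-step : ∀ a b n → b ⊓ n ∸ a + length (filter (inInterval? a b) List.[ n ]) ≡ b ⊓ suc n ∸ a
count-interval-step a b n with a ≤? n | n <? b
... | yes a≤n | yes n<b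
  rewrite filter-accept (inInterval? a b) {xs = []} (a≤n , n<b) | m≥n⇒m⊓n≡n (<⇒≤ n<b) | m≥n⇒m⊓n≡n n<b
  = trans (sym (+-∸-comm 1 a≤n)) (cong (_∸ a) (+-comm n 1))
... | no a≰n | yes n<b
  rewrite filter-reject (inInterval? a b) {xs = []} (a≰n ∘ proj₁) | m≥n⇒m⊓n≡n (<⇒≤ n<b) | m≥n⇒m⊓n≡n n<b
  = trans (+-identityʳ _) (trans (m≤n⇒m∸n≡0 (<⇒≤ (≰⇒> a≰n))) (sym (m≤n⇒m∸n≡0 (≰⇒> a≰n))))
... | _ | no n≮b
  rewrite filter-reject (inInterval? a b) {xs = []} (n≮b ∘ proj₂)
        | m≤n⇒m⊓n≡m (≮⇒≥ n≮b) | m≤n⇒m⊓n≡m (m≤n⇒m≤1+n (≮⇒≥ n≮b))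
  = +-identityʳ _

count-interval : ∀ a b n → length (filter (inInterval? a b) (upTo n)) ≡ b ⊓ n ∸ a
count-interval a b zero    = sym (trans (cong (_∸ a) (⊓-zeroʳ b)) (0∸n≡0 a))
count-interval a b (suc n) = begin
  length (filter (inInterval? a b) (upTo (suc n)))
    ≡⟨ length-filter-upTo-suc (inInterval? a b) n ⟩
  length (filter (inInterval? a b) (upTo n)) + length (filter (inInterval? a b) List.[ n ])
    ≡⟨ cong (_+ length (filter (inInterval? a b) List.[ n ])) (count-interval a b n) ⟩
  b ⊓ n ∸ a + length (filter (inInterval? a b) List.[ n ])
    ≡⟨ count-interval-step a b n ⟩
  b ⊓ suc n ∸ a ∎
  where open ≡-Reasoning

2*m∸[m∸n]≡m+n : ∀ {m n} → n ≤ m → 2 * m ∸ (m ∸ n) ≡ m + n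
2*m∸[m∸n]≡m+n {m} {n} n≤m = begin
  2 * m ∸ (m ∸ n)       ≡⟨ cong (_∸ (m ∸ n)) (cong (m +_) (+-identityʳ m)) ⟩
  m + m ∸ (m ∸ n)       ≡⟨ +-∸-assoc m (m∸n≤m m n) ⟩
  m + (m ∸ (m ∸ n))     ≡⟨ cong (m +_) (m∸[m∸n]≡n n≤m) ⟩
  m + n                 ∎
  where open ≡-Reasoning

2*m∸2*[m∸n]≡n+n : ∀ {m n} → n ≤ m → 2 * m ∸ 2 * (m ∸ n) ≡ n + n
2*m∸2*[m∸n]≡n+n {m} {n} n≤m = begin
  2 * m ∸ 2 * (m ∸ n)   ≡⟨ *-distribˡ-∸ 2 m (m ∸ n) ⟨
  2 * (m ∸ (m ∸ n))     ≡⟨ cong (2 *_) (m∸[m∸n]≡n n≤m) ⟩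
  2 * n                 ≡⟨ cong (n +_) (+-identityʳ n) ⟩
  n + n                 ∎
  where open ≡-Reasoning

m∸[n⊓m]≡m∸n : ∀ m n → m ∸ (n ⊓ m) ≡ m ∸ n
m∸[n⊓m]≡m∸n m n = begin
  m ∸ (n ⊓ m)             ≡⟨ ∸-distribˡ-⊓-⊔ m n m ⟩
  (m ∸ n) ⊔ (m ∸ m)       ≡⟨ cong ((m ∸ n) ⊔_) (n∸n≡0 m) ⟩
  (m ∸ n) ⊔ 0             ≡⟨ ⊔-identityʳ (m ∸ n) ⟩
  m ∸ n                   ∎
  where open ≡-Reasoning

overlapSize-ordered : ∀ {n k i j} → i ≤ j → i + k ≤ n → overlapSize n k i j ≡ k ∸ (j ∸ i)
overlapSize-ordered {n} {k} {i} {j} i≤j hi = begin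
  overlapSize n k i j
    ≡⟨ cong length (filter-≐ _ (inInterval? j (i + k)) (both⇒interval , interval⇒both) (upTo n)) ⟩
  length (filter (inInterval? j (i + k)) (upTo n))    ≡⟨ count-interval j (i + k) n ⟩
  (i + k) ⊓ n ∸ j                                    ≡⟨ cong (_∸ j) (m≤n⇒m⊓n≡m hi) ⟩
  i + k ∸ j                                          ≡⟨ cong (i + k ∸_) (m+[n∸m]≡n i≤j) ⟨
  i + k ∸ (i + (j ∸ i))                              ≡⟨ [m+n]∸[m+o]≡n∸o i k (j ∸ i) ⟩
  k ∸ (j ∸ i)                                        ∎
  where
  open ≡-Reasoning
  both⇒interval : ∀ {p} → InWin k i p × InWin k j p → j ≤ p × p < i + k
  both⇒interval ((_ , p<i+k) , (j≤p , _)) = j≤p , p<i+k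
  interval⇒both : ∀ {p} → j ≤ p × p < i + k → InWin k i p × InWin k j p
  interval⇒both (j≤p , p<i+k) = (≤-trans i≤j j≤p , p<i+k) , (j≤p , <-≤-trans p<i+k (+-monoˡ-≤ k i≤j))

module Gluing {n k q i j : ℕ} (q≤k : q ≤ k) (hi : i + k ≤ n) (hj : j + k ≤ n)
  (i+q≤j : i + q ≤ j) (overlapping : q < k → i + q ≡ j) where

  open Union q≤k

  -- glue lists the union of [i, i + k) and [j, j + k) in increasing order.
  glue : ℕ → ℕ
  glue c with c <? q
  ... | yes _ = i + c
  ... | no _  = j + (c ∸ q)

  glue-left : ∀ {c} → c < q → glue c ≡ i + c
  glue-left {c} c<q with c <? q
  ... | yes _   = refl
  ... | no c≮q  = contradiction c<q c≮q

  glue-right : ∀ {c} → q ≤ c → glue c ≡ j + (c ∸ q)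
  glue-right {c} q≤c with c <? q
  ... | yes c<q = contradiction q≤c (<⇒≱ c<q)
  ... | no _    = refl

  glue-< : ∀ c → c < k + q → glue c < n
  glue-< c c<k+q with c <? q
  ... | yes c<q = <-≤-trans (+-monoʳ-< i (<-≤-trans c<q q≤k)) hi
  ... | no c≮q  = <-≤-trans (+-monoʳ-< j (subst (c ∸ q <_) (m+n∸n≡m k q) (∸-monoˡ-< c<k+q (≮⇒≥ c≮q)))) hj

  glue-left<right : ∀ {c d} → c < q → q ≤ d → glue c < glue d
  glue-left<right {c} {d} c<q q≤d = begin-strict
    glue c        ≡⟨ glue-left c<q ⟩
    i + c         <⟨ +-monoʳ-< i c<q ⟩
    i + q         ≤⟨ i+q≤j ⟩
    j             ≤⟨ m≤m+n j (d ∸ q) ⟩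
    j + (d ∸ q)   ≡⟨ glue-right q≤d ⟨
    glue d        ∎
    where open ≤-Reasoning

  glue-injective : ∀ {c d} → glue c ≡ glue d → c ≡ d
  glue-injective {c} {d} eq = go (c <? q) (d <? q)
    where
    go : Dec (c < q) → Dec (d < q) → c ≡ d
    go (yes c<q) (yes d<q) = +-cancelˡ-≡ i _ _ (trans (sym (glue-left c<q)) (trans eq (glue-left d<q)))
    go (yes c<q) (no d≮q)  = contradiction eq (<⇒≢ (glue-left<right c<q (≮⇒≥ d≮q)))
    go (no c≮q)  (yes d<q) = contradiction (sym eq) (<⇒≢ (glue-left<right d<q (≮⇒≥ c≮q)))
    go (no c≮q)  (no d≮q)  = ∸-cancelʳ-≡ (≮⇒≥ c≮q) (≮⇒≥ d≮q)
      (+-cancelˡ-≡ j _ _ (trans (sym (glue-right (≮⇒≥ c≮q))) (trans eq (glue-right (≮⇒≥ d≮q)))))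

  union : Fin (k + q) → Fin n
  union c = fromℕ< (glue-< (toℕ c) (toℕ<n c))

  toℕ-union : ∀ c → toℕ (union c) ≡ glue (toℕ c)
  toℕ-union c = toℕ-fromℕ< _

  union-injective : Injective _≡_ _≡_ union
  union-injective {c} {d} eq = toℕ-injective (glue-injective
    (trans (sym (toℕ-union c)) (trans (cong toℕ eq) (toℕ-union d))))

  union-firstWindow : ∀ a → union (firstWindow a) ≡ winPos i hi a
  union-firstWindow a = toℕ-injective (begin
    toℕ (union (firstWindow a))   ≡⟨ toℕ-union (firstWindow a) ⟩
    glue (toℕ (firstWindow a))    ≡⟨ cong glue (toℕ-firstWindow a) ⟩
    glue (toℕ a)                  ≡⟨ glue-first (toℕ a <? q) ⟩
    i + toℕ a                     ≡⟨ toℕ-winPos i hi a ⟨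
    toℕ (winPos i hi a)           ∎)
    where
    open ≡-Reasoning
    glue-first : Dec (toℕ a < q) → glue (toℕ a) ≡ i + toℕ a
    glue-first (yes a<q) = glue-left a<q
    glue-first (no a≮q)  = begin
      glue (toℕ a)                    ≡⟨ glue-right (≮⇒≥ a≮q) ⟩
      j + (toℕ a ∸ q)                 ≡⟨ cong (_+ (toℕ a ∸ q)) (overlapping (≤-<-trans (≮⇒≥ a≮q) (toℕ<n a))) ⟨
      i + q + (toℕ a ∸ q)             ≡⟨ +-assoc i q _ ⟩
      i + (q + (toℕ a ∸ q))           ≡⟨ cong (i +_) (m+[n∸m]≡n (≮⇒≥ a≮q)) ⟩
      i + toℕ a                       ∎

  union-secondWindow : ∀ a → union (secondWindow a) ≡ winPos j hj a
  union-secondWindow a = toℕ-injective (begin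
    toℕ (union (secondWindow a))  ≡⟨ toℕ-union (secondWindow a) ⟩
    glue (toℕ (secondWindow a))   ≡⟨ cong glue (toℕ-secondWindow a) ⟩
    glue (q + toℕ a)              ≡⟨ glue-right (m≤m+n q (toℕ a)) ⟩
    j + (q + toℕ a ∸ q)           ≡⟨ cong (j +_) (m+n∸m≡n q (toℕ a)) ⟩
    j + toℕ a                     ≡⟨ toℕ-winPos j hj a ⟨
    toℕ (winPos j hj a)           ∎)
    where open ≡-Reasoning

  module _ (μ : Permutation′ k) where

    private
      occurrences-copy : ∀ {v v′ ℓ} {h : ℓ + k ≤ n} → Occ v μ ℓ h → Occ v′ μ ℓ h →
        CopiesOrder (lookup v ∘ winPos ℓ h) (lookup v′ ∘ winPos ℓ h)
      occurrences-copy occ occ′ a b lt = proj₁ (occ′ a b) (proj₂ (occ a b) lt)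

      first-copy : ∀ {v v′} → Occ v μ i hi → Occ v′ μ i hi →
        CopiesOrder (lookup v ∘ union ∘ firstWindow) (lookup v′ ∘ union ∘ firstWindow)
      first-copy {v} {v′} occ occ′ = copies-restrict {f = lookup v} {lookup v′} {e = winPos i hi} {union ∘ firstWindow}
        (λ a → a , sym (union-firstWindow a)) (occurrences-copy {v} {v′} {i} {hi} occ occ′)

      second-copy : ∀ {v v′} → Occ v μ j hj → Occ v′ μ j hj →
        CopiesOrder (lookup v ∘ union ∘ secondWindow) (lookup v′ ∘ union ∘ secondWindow)
      second-copy {v} {v′} occ occ′ = copies-restrict {f = lookup v} {lookup v′} {e = winPos j hj} {union ∘ secondWindow}
        (λ a → a , sym (union-secondWindow a)) (occurrences-copy {v} {v′} {j} {hj} occ occ′)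

      DoubleOccurrence : Vec (Fin n) n → Set
      DoubleOccurrence v = Occ v μ i hi × Occ v μ j hj

      double-occurrences-copy : ∀ {v v′} → IsPerm v → IsPerm v′ → DoubleOccurrence v → DoubleOccurrence v′ →
        code (lookup v ∘ union) ≡ code (lookup v′ ∘ union) → CopiesOrder (lookup v ∘ union) (lookup v′ ∘ union)
      double-occurrences-copy {v} {v′} v-perm v′-perm (occᵢ , occⱼ) (occᵢ′ , occⱼ′) =
        copiesOrder-from-windows {f = lookup v ∘ union} {lookup v′ ∘ union}
        (λ eq → union-injective (v-perm _ _ eq)) (λ eq → union-injective (v′-perm _ _ eq))
        (first-copy {v} {v′} occᵢ occᵢ′) (first-copy {v′} {v} occᵢ′ occᵢ)
        (second-copy {v} {v′} occⱼ occⱼ′) (second-copy {v′} {v} occⱼ′ occⱼ)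

    countBoth-bound : countBoth n k μ i j hi hj * length (Perms (k + q)) ≤ length (Perms n) * 2 ^ (q + q)
    countBoth-bound = filter-Perms-bound union union-injective (λ v → occ? v μ i hi ×-dec occ? v μ j hj)
      (λ v → code (lookup v ∘ union)) (λ {v} {v′} → double-occurrences-copy {v} {v′})

countBoth-bound-ordered : ∀ {n k} (μ : Permutation′ k) {i j} → i ≤ j → (hi : i + k ≤ n) (hj : j + k ≤ n) →
  countBoth n k μ i j hi hj * ((2 * k ∸ overlapSize n k i j) !) ≤ 2 ^ (2 * k ∸ 2 * overlapSize n k i j) * length (Perms n)
countBoth-bound-ordered {n} {k} μ {i} {j} i≤j hi hj = begin
  N * ((2 * k ∸ overlapSize n k i j) !)         ≡⟨ cong (λ r → N * ((2 * k ∸ r) !)) r≡k∸s ⟩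
  N * ((2 * k ∸ (k ∸ s)) !)                     ≡⟨ cong (λ e → N * (e !)) (2*m∸[m∸n]≡m+n s≤k) ⟩
  N * ((k + s) !)                               ≤⟨ *-monoʳ-≤ N (factorial-≤-Perms (k + s)) ⟩
  N * length (Perms (k + s))                    ≤⟨ Gluing.countBoth-bound s≤k hi hj i+s≤j overlapping μ ⟩
  length (Perms n) * 2 ^ (s + s)                ≡⟨ *-comm (length (Perms n)) _ ⟩
  2 ^ (s + s) * length (Perms n)                ≡⟨ cong (λ e → 2 ^ e * length (Perms n)) 2k∸2r≡s+s ⟨
  2 ^ (2 * k ∸ 2 * overlapSize n k i j) * length (Perms n) ∎
  where
  open ≤-Reasoning
  N : ℕ
  N = countBoth n k μ i j hi hj

  s : ℕ
  s = (j ∸ i) ⊓ k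

  s≤k : s ≤ k
  s≤k = m⊓n≤n (j ∸ i) k

  i+s≤j : i + s ≤ j
  i+s≤j = ≤-trans (+-monoʳ-≤ i (m⊓n≤m (j ∸ i) k)) (≤-reflexive (m+[n∸m]≡n i≤j))

  overlapping : s < k → i + s ≡ j
  overlapping s<k = trans (cong (i +_) (m≤n⇒m⊓n≡m j∸i≤k)) (m+[n∸m]≡n i≤j)
    where
    j∸i≤k : j ∸ i ≤ k
    j∸i≤k = ≮⇒≥ λ k<j∸i → <-irrefl (m≥n⇒m⊓n≡n (<⇒≤ k<j∸i)) s<k

  r≡k∸s : overlapSize n k i j ≡ k ∸ s
  r≡k∸s = trans (overlapSize-ordered i≤j hi) (sym (m∸[n⊓m]≡m∸n k (j ∸ i)))

  2k∸2r≡s+s : 2 * k ∸ 2 * overlapSize n k i j ≡ s + s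
  2k∸2r≡s+s = trans (cong (λ r → 2 * k ∸ 2 * r) r≡k∸s) (2*m∸2*[m∸n]≡n+n s≤k)

countBoth-comm : ∀ n k μ i j hi hj → countBoth n k μ i j hi hj ≡ countBoth n k μ j i hj hi
countBoth-comm n k μ i j hi hj = cong length (filter-≐ _ _ (swap , swap) (Perms n))

overlapSize-comm : ∀ n k i j → overlapSize n k i j ≡ overlapSize n k j i
overlapSize-comm n k i j = cong length (filter-≐ _ _ (swap , swap) (upTo n))

lemma2p1 : (n k : ℕ) → 1 ≤ k → k ≤ n → (μ : Permutation′ k) →
    (i j : ℕ) (hi : i + k ≤ n) (hj : j + k ≤ n) → (r : ℕ) → r ≡ overlapSize n k i j →
    countBoth n k μ i j hi hj * ((2 * k ∸ r) !) ≤ (2 ^ (2 * k ∸ 2 * r)) * length (Perms n)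
lemma2p1 n k _ _ μ i j hi hj r refl with ≤-total i j
... | inj₁ i≤j = countBoth-bound-ordered μ i≤j hi hj
... | inj₂ j≤i rewrite countBoth-comm n k μ i j hi hj | overlapSize-comm n k i j =
  countBoth-bound-ordered μ j≤i hj hi
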